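{- Let $t\in\mathbb{N}$ and let $\mathscr{C}$ be the class of $K_{t,t}$-free graphs. Then the semi-ladder index of the class $\delta_1(\mathscr{C})$ is smaller than $3t$.
   Context: A graph is $K_{t,t}$-free if it does not contain the complete bipartite graph $K_{t,t}$ as a subgraph. For a graph $G$, $\delta_1(G)$ is the bipartite graph with left and right part $V(G)$ in which $a,b$ are adjacent iff $\mathrm{dist}_G(a,b)\le 1$ (i.e., $a=b$ or $ab\in E(G)$); $\delta_1(\mathscr{C})=\{\delta_1(G):G\in\mathscr{C}\}$. In a bipartite graph $(L,R,E)$ a semi-ladder of order $n$ consists of $a_1,\dots,a_n\in L$, $b_1,\dots,b_n\in R$ with $(a_i,b_j)\in E$ for all $i>j$ and $(a_i,b_i)\notin E$ for all $i$; the semi-ladder index of a class is the supremum of the orders of semi-ladders in its members. -}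

module Defs where

open import Level using (0ℓ)
open import Data.Nat using (ℕ; _<_)
open import Data.Fin using (Fin)
open import Data.Product using (Σ; _×_; ∃)
open import Data.Sum using (_⊎_)
open import Relation.Nullary using (¬_)
open import Relation.Binary.PropositionalEquality using (_≡_; _≢_)
open import Function.Definitions using (Injective)

record Graph : Set₁ where
  field
    n     : ℕ
    E     : Fin n → Fin n → Set
    sym   : ∀ {u v} → E u v → E v u
    irrefl : ∀ {u} → ¬ E u u
open Graph public

ContainsKtt : ℕ → Graph → Set
ContainsKtt t G =
  Σ (Fin t → Fin (n G)) λ f → Σ (Fin t → Fin (n G)) λ g →
    Injective _≡_ _≡_ f × Injective _≡_ _≡_ g ×
    (∀ i j → f i ≢ g j) × (∀ i j → E G (f i) (g j))

KttFree : ℕ → Graph → Set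
KttFree t G = ¬ ContainsKtt t G

record BipGraph : Set₁ where
  field
    L R : Set
    Adj : L → R → Set
open BipGraph public

δ₁ : Graph → BipGraph
δ₁ G = record { L = Fin (n G) ; R = Fin (n G) ; Adj = λ a b → (a ≡ b) ⊎ E G a b }

SemiLadder : (H : BipGraph) → ℕ → Set
SemiLadder H k =
  Σ (Fin k → L H) λ a → Σ (Fin k → R H) λ b →
    (∀ i j → Data.Fin._<_ j i → Adj H (a i) (b j)) × (∀ i → ¬ Adj H (a i) (b i))

module Submission where

-- Let a₁ … a_k, b₁ … b_k be a semi-ladder in δ₁(G) with k ≥ 3t.
-- In every semi-ladder both sides consist of pairwise distinct elements: if
-- aᵢ = aⱼ with j < i, then aᵢ ~ bⱼ = aⱼ ~ bⱼ, contradicting aⱼ ≁ bⱼ (dually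
-- for b).  Restrict to the first 3t rungs, let A be the top t left vertices
-- and B the bottom 2t right vertices; every vertex of A is δ₁-adjacent to
-- every vertex of B.  At most t vertices of B coincide with a vertex of A, so
-- t vertices of B avoid A entirely, and δ₁-adjacency between distinct vertices
-- is an edge of G.  This yields a K_{t,t} in G, so a K_{t,t}-free G only has
-- semi-ladders of order < 3t.

open import Defs hiding (sym)
open import Data.Nat as ℕ using (ℕ; _<_; _*_; _+_; _≤_)
import Data.Nat.Properties as ℕₚ
open import Data.Fin as Fin using (Fin; zero; suc; toℕ; inject₁; inject≤; punchIn; _↑ˡ_; _↑ʳ_)
open import Data.Fin.Properties
  using (<-cmp; toℕ<n; toℕ-inject≤; toℕ-↑ˡ; toℕ-↑ʳ;
         ↑ˡ-injective; ↑ʳ-injective; inject₁-injective; punchIn-injective;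
         punchInᵢ≢i; any?)
open import Data.Product using (Σ; _×_; _,_; proj₁; proj₂)
open import Data.Sum using (inj₁; inj₂)
open import Data.Empty using (⊥-elim)
open import Relation.Nullary using (¬_; yes; no)
open import Relation.Binary using (tri<; tri≈; tri>)
open import Relation.Binary.Definitions using (DecidableEquality)
open import Relation.Binary.PropositionalEquality
open import Function using (_∘_; id)
open import Function.Definitions using (Injective)

-- Both sides of a semi-ladder are injective: a repeated vertex would turn a
-- required non-edge aᵢ ≁ bᵢ into one of the required edges.
module _ (H : BipGraph) {k : ℕ} (a : Fin k → L H) (b : Fin k → R H)
  (below : ∀ i j → j Fin.< i → Adj H (a i) (b j))
  (diagonal : ∀ i → ¬ Adj H (a i) (b i)) where

  semiLadder-left-injective : Injective _≡_ _≡_ a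
  semiLadder-left-injective {i} {i′} a≡ with <-cmp i i′
  ... | tri< i<i′ _ _ = ⊥-elim (diagonal i (subst (λ v → Adj H v (b i)) (sym a≡) (below i′ i i<i′)))
  ... | tri≈ _ i≡i′ _ = i≡i′
  ... | tri> _ _ i>i′ = ⊥-elim (diagonal i′ (subst (λ v → Adj H v (b i′)) a≡ (below i i′ i>i′)))

  semiLadder-right-injective : Injective _≡_ _≡_ b
  semiLadder-right-injective {i} {i′} b≡ with <-cmp i i′
  ... | tri< i<i′ _ _ = ⊥-elim (diagonal i′ (subst (Adj H (a i′)) b≡ (below i′ i i<i′)))
  ... | tri≈ _ i≡i′ _ = i≡i′
  ... | tri> _ _ i>i′ = ⊥-elim (diagonal i (subst (Adj H (a i)) (sym b≡) (below i i′ i>i′)))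

semiLadder-prefix : (H : BipGraph) {m k : ℕ} → m ≤ k → SemiLadder H k → SemiLadder H m
semiLadder-prefix H m≤k (a , b , below , diagonal) =
  a ∘ embed , b ∘ embed , (λ i j j<i → below (embed i) (embed j) (embed-mono j<i)) , diagonal ∘ embed
  where
    embed : Fin _ → Fin _
    embed i = inject≤ i m≤k
    embed-mono : ∀ {i j} → i Fin.< j → embed i Fin.< embed j
    embed-mono {i} {j} = subst₂ _<_ (sym (toℕ-inject≤ i m≤k)) (sym (toℕ-inject≤ j m≤k))

module _ {V : Set} (_≟_ : DecidableEquality V) where

  -- Removing one index from an injective family of size c + 1 + m so that the
  -- remaining members all differ from a given vertex v: drop the index whose
  -- value is v if there is one, and the last index otherwise.
  dropMatch : ∀ c m (b : Fin (ℕ.suc c + m) → V) → Injective _≡_ _≡_ b → (v : V) →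
    Σ (Fin (c + m) → Fin (ℕ.suc c + m)) λ e → Injective _≡_ _≡_ e × (∀ x → v ≢ b (e x))
  dropMatch c m b b-inj v with any? (λ j → v ≟ b j)
  ... | no v∉b = inject₁ , inject₁-injective , λ x v≡ → v∉b (_ , v≡)
  ... | yes (j , v≡bj) =
    punchIn j , (λ {x} {y} → punchIn-injective j x y) ,
    λ x v≡ → punchInᵢ≢i j x (sym (b-inj (trans (sym v≡bj) v≡)))

  avoidFamily : ∀ c m (b : Fin (c + m) → V) → Injective _≡_ _≡_ b → (a : Fin c → V) →
    Σ (Fin m → Fin (c + m)) λ h → Injective _≡_ _≡_ h × (∀ x y → a y ≢ b (h x))
  avoidFamily ℕ.zero m b b-inj a = id , id , λ x ()
  avoidFamily (ℕ.suc c) m b b-inj a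
    with dropMatch c m b b-inj (a zero)
  ... | e , e-inj , avoids-a₀
    with avoidFamily c m (b ∘ e) (e-inj ∘ b-inj) (a ∘ suc)
  ... | h , h-inj , avoids-rest =
    e ∘ h , h-inj ∘ e-inj , λ { x zero → avoids-a₀ (h x) ; x (suc y) → avoids-rest x y }

δ₁-edge : (G : Graph) {u v : Fin (n G)} → Adj (δ₁ G) u v → u ≢ v → E G u v
δ₁-edge G (inj₁ u≡v) u≢v = ⊥-elim (u≢v u≡v)
δ₁-edge G (inj₂ uv)  u≢v = uv

-- A semi-ladder of order 3t in δ₁(G) yields a K_{t,t} in G: the top t left
-- vertices together with t of the bottom 2t right vertices avoiding them.
semiLadder⇒Ktt : (t : ℕ) (G : Graph) → SemiLadder (δ₁ G) ((t + t) + t) → ContainsKtt t G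
semiLadder⇒Ktt t G (a , b , below , diagonal) =
  a ∘ top , b ∘ bottom ∘ h , a-top-inj , h-inj ∘ b-bottom-inj , disjoint ,
  λ i j → δ₁-edge G (below (top i) (bottom (h j)) (bottom<top i (h j))) (disjoint i j)
  where
    top : Fin t → Fin ((t + t) + t)
    top i = (t + t) ↑ʳ i
    bottom : Fin (t + t) → Fin ((t + t) + t)
    bottom j = j ↑ˡ t
    bottom<top : ∀ i j → bottom j Fin.< top i
    bottom<top i j = subst₂ _<_ (sym (toℕ-↑ˡ j t)) (sym (toℕ-↑ʳ (t + t) i))
                       (ℕₚ.<-≤-trans (toℕ<n j) (ℕₚ.m≤m+n (t + t) (toℕ i)))
    a-top-inj : Injective _≡_ _≡_ (a ∘ top)
    a-top-inj {i} {i′} = ↑ʳ-injective (t + t) i i′ ∘ semiLadder-left-injective (δ₁ G) a b below diagonal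
    b-bottom-inj : Injective _≡_ _≡_ (b ∘ bottom)
    b-bottom-inj {j} {j′} = ↑ˡ-injective t j j′ ∘ semiLadder-right-injective (δ₁ G) a b below diagonal
    avoiding = avoidFamily Fin._≟_ t t (b ∘ bottom) b-bottom-inj (a ∘ top)
    h : Fin t → Fin (t + t)
    h = proj₁ avoiding
    h-inj : Injective _≡_ _≡_ h
    h-inj = proj₁ (proj₂ avoiding)
    disjoint : ∀ i j → a (top i) ≢ b (bottom (h j))
    disjoint i j = proj₂ (proj₂ avoiding) j i

lemma34 : (t : ℕ) (G : Graph) → KttFree t G →
    (k : ℕ) → SemiLadder (δ₁ G) k → k < 3 * t
lemma34 t G free k ladder with k ℕₚ.<? 3 * t
... | yes k<3t = k<3t
... | no k≮3t = ⊥-elim (free (semiLadder⇒Ktt t G (semiLadder-prefix (δ₁ G) 3t≤k ladder)))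
  where
    3t≤k : (t + t) + t ≤ k
    3t≤k = subst (_≤ k) (trans (cong (λ s → t + (t + s)) (ℕₚ.+-identityʳ t)) (sym (ℕₚ.+-assoc t t t)))
                 (ℕₚ.≮⇒≥ k≮3t)
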